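{- Let $J$ be a set of unit-time, unit-consumption jobs with acyclic precedence graph $G$, let $P$ be a critical path of $G$, and let $x$ be a feasible schedule with makespan at most $M=|P|$. Let $a,b\in J$ be two independent jobs such that $x_a<x_b$ and $a$ is the only job scheduled at time step $x_a$. Then the schedule $x'$ obtained from $x$ by the elementary operation on $a$ and $b$ is feasible (with makespan at most $|P|$), and $F(x')=F(x)$ if exactly two jobs are scheduled at $x_b$ in $x$, while $F(x')=F(x)+1$ otherwise.
   Context: Schedules are integer starting-time vectors $x\in\mathbb{N}^J$; a schedule is feasible if $x_i+1\le x_j$ for every arc $(i,j)$ of $G$ and $\max_i(x_i+1)\le M$. A job $i$ is "scheduled at time step $\tau$" if $x_i=\tau$. With $r_\tau(x)$ the number of jobs scheduled at $\tau$, $F(x)=\sum_{\tau=0}^{C_{max}(x)-1}\min(2,r_\tau(x))$, where $C_{max}(x)=\max_i(x_i+1)$. A critical path is a path in $G$ with the maximum number of jobs. Two distinct jobs are independent if there is no directed path between them in $G$. Elementary operation on $a,b$ (with $x_a<x_b$): let $\tau_1<\dots<\tau_K$ be the time steps in $\{x_a+1,\dots,x_b-1\}$ at which at least one predecessor (in $G$, i.e. a job with a directed path to $b$) of $b$ is scheduled, and set $\tau_0=x_a$, $\tau_{K+1}=x_b$. For each $k\in\{1,\dots,K\}$, let $\beta_k$ be the set of predecessors of $b$ scheduled at $\tau_k$. The new schedule $x'$ is obtained by moving every job of $\beta_k$ from $\tau_k$ to $\tau_{k-1}$ for each $k\in\{1,\dots,K\}$, moving $b$ from $\tau_{K+1}$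 to $\tau_K$, and leaving all other jobs unchanged. -}

module Defs where

open import Data.Nat using (ℕ; zero; suc; _+_; _≤_; _<_; _⊔_; _⊓_; _<?_)
open import Data.Nat.Properties using (_≟_)
open import Data.Fin using (Fin)
open import Data.List using (List; []; _∷_; length; filter; allFin; foldr; map; upTo)
open import Data.Nat.ListAction using (sum)
open import Data.Bool.ListAction using (any)
open import Data.Bool using (Bool; true; false; _∧_; if_then_else_)
open import Data.Product using (_×_)
open import Relation.Nullary using (¬_; Dec; yes; no; does)
open import Relation.Binary.PropositionalEquality using (_≡_; _≢_)

-- Jobs are Fin n; the precedence graph G is a relation Arc on jobs (arcs (i,j)).
-- A schedule is x : Fin n → ℕ (starting times).

Schedule : ℕ → Set
Schedule n = Fin n → ℕ

data Reach {n : ℕ} (Arc : Fin n → Fin n → Set) : Fin n → Fin n → Set where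
  step : ∀ {i j} → Arc i j → Reach Arc i j
  cons : ∀ {i j k} → Arc i j → Reach Arc j k → Reach Arc i k

Acyclic : {n : ℕ} → (Fin n → Fin n → Set) → Set
Acyclic {n} Arc = ∀ (i : Fin n) → ¬ Reach Arc i i

data IsPath {n : ℕ} (Arc : Fin n → Fin n → Set) : List (Fin n) → Set where
  nil  : IsPath Arc []
  one  : ∀ i → IsPath Arc (i ∷ [])
  more : ∀ {i j ps} → Arc i j → IsPath Arc (j ∷ ps) → IsPath Arc (i ∷ j ∷ ps)

IsCriticalPath : {n : ℕ} → (Fin n → Fin n → Set) → List (Fin n) → Set
IsCriticalPath Arc P = IsPath Arc P × (∀ Q → IsPath Arc Q → length Q ≤ length P)

Independent : {n : ℕ} → (Fin n → Fin n → Set) → Fin n → Fin n → Set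
Independent Arc a b = (a ≢ b) × ¬ Reach Arc a b × ¬ Reach Arc b a

Cmax : {n : ℕ} → Schedule n → ℕ
Cmax {n} x = foldr (λ i m → suc (x i) ⊔ m) 0 (allFin n)

Feasible : {n : ℕ} → (Fin n → Fin n → Set) → ℕ → Schedule n → Set
Feasible Arc M x = (∀ i j → Arc i j → x i + 1 ≤ x j) × (Cmax x ≤ M)

r : {n : ℕ} → Schedule n → ℕ → ℕ
r {n} x τ = length (filter (λ i → x i ≟ τ) (allFin n))

F : {n : ℕ} → Schedule n → ℕ
F x = sum (map (λ τ → 2 ⊓ r x τ) (upTo (Cmax x)))

-- The predecessors of b (jobs with a directed
-- path to b) are given through a decision procedure pred? (any two such
-- procedures give the same answers, so the result does not depend on it).
module Elementary {n : ℕ} (Arc : Fin n → Fin n → Set) (x : Schedule n)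
                  (a b : Fin n) (pred? : ∀ j → Dec (Reach Arc j b)) where

  hasPred : ℕ → Bool
  hasPred t = any (λ j → does (pred? j) ∧ does (x j ≟ t)) (allFin n)

  -- prev t = largest s with x_a < s < t at which a predecessor of b is
  -- scheduled, or x_a if there is none.
  prev : ℕ → ℕ
  prev zero    = x a
  prev (suc s) = if does (x a <? s) ∧ hasPred s then s else prev s

  -- Job b goes from τ_{K+1} = x_b to τ_K = prev x_b; a predecessor of b at
  -- τ_k (x_a < τ_k < x_b) goes to τ_{k-1} = prev τ_k; others stay.
  x′ : Schedule n
  x′ j with does (Data.Fin._≟_ j b)
  ... | true  = prev (x b)
  ... | false = if does (pred? j) ∧ does (x a <? x j) ∧ does (x j <? x b)
                then prev (x j) else x j

elementaryOp : {n : ℕ} (Arc : Fin n → Fin n → Set) (x : Schedule n) (a b : Fin n)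
               (pred? : ∀ j → Dec (Reach Arc j b)) → Schedule n
elementaryOp Arc x a b pred? = Elementary.x′ Arc x a b pred?

-- Since x fits into M ≤ |P| steps, the path P is scheduled back to back, one job per step
-- 0, 1, …, M - 1. As a is alone at x a, the jobs of P from x a on are a and jobs reachable
-- from a; these are neither b nor predecessors of b, so the operation never moves them, and
-- they keep every step after x a (in particular the last one, so the makespan is unchanged)
-- occupied. The operation shifts b and the predecessors of b between x a and x b down the
-- chain x b > τ_K > … > τ_1 > x a one link each, which keeps all precedences because a
-- predecessor of a moved job is itself moved or scheduled before x a. Comparing
-- min(2, r_τ) step by step: at x a it rises from 1 to 2, at each τ_k it stays 2 (a job of P
-- remains and a moved job arrives), at x b it loses one job and so drops by one exactly when
-- r x (x b) = 2, and elsewhere nothing changes.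
-- Acyclicity is implied by feasibility, and of the critical path only that it is a path with
-- |P| jobs is used.
{-# OPTIONS --safe #-}
module Submission where

open import Defs
open import Level using (0ℓ)
open import Data.Nat using (ℕ; zero; suc; _+_; _∸_; _≤_; _<_; _⊓_; _⊔_; z≤n; s≤s)
open import Data.Nat.Properties
open import Data.Nat.Induction using (<-wellFounded)
open import Data.Nat.ListAction using (sum)
open import Data.Nat.ListAction.Properties using (sum-++)
open import Data.Bool using (Bool; T; if_then_else_)
open import Data.Fin using (Fin)
import Data.Fin as Fin
open import Data.List using (List; []; _∷_; _++_; length; filter; allFin; foldr; map; upTo)
open import Data.List.Properties using (upTo-∷ʳ; map-++; map-cong; filter-some; filter-none)
open import Data.List.Relation.Unary.All as All using (All; []; _∷_)
open import Data.List.Relation.Unary.Any using (here; there; satisfied)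
open import Data.List.Relation.Unary.Any.Properties using (any⁺; any⁻)
open import Data.List.Relation.Unary.AllPairs using (_∷_)
open import Data.List.Relation.Unary.Unique.Propositional using (Unique)
open import Data.List.Relation.Unary.Unique.Propositional.Properties using (allFin⁺)
open import Data.List.Membership.Propositional using (_∈_; lose)
open import Data.List.Membership.Propositional.Properties using (∈-allFin)
open import Data.Product using (_×_; _,_; proj₁; proj₂; ∃)
open import Data.Sum using (_⊎_; inj₁; inj₂; [_,_])
open import Function using (_∘_; _⇔_; mk⇔; Equivalence)
open import Induction.WellFounded using (Acc; acc)
open import Relation.Nullary using (¬_; Dec; yes; no; does; contradiction)
open import Relation.Nullary.Decidable
  using (_×-dec_; _⊎-dec_; ¬?; T?; dec-true; dec-false)
import Relation.Nullary.Decidable as Dec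
open import Relation.Unary using (Pred; Decidable)
open import Relation.Binary.PropositionalEquality
  using (_≡_; _≢_; refl; sym; trans; cong; cong₂; subst; ≢-sym; module ≡-Reasoning)
open import Algebra.Properties.CommutativeSemigroup +-commutativeSemigroup using (interchange)

module _ {A : Set} {P Q : Pred A 0ℓ} (P? : Decidable P) (Q? : Decidable Q) where

  private
    length-filter-∷ : ∀ {y ys} k → P y ⇔ Q y →
      length (filter P? ys) ≡ k + length (filter Q? ys) →
      length (filter P? (y ∷ ys)) ≡ k + length (filter Q? (y ∷ ys))
    length-filter-∷ {y} k P⇔Q eq with P? y | Q? y
    ... | yes _ | yes _ = trans (cong suc eq) (sym (+-suc k _))
    ... | no _  | no _  = eq
    ... | yes p | no ¬q = contradiction (Equivalence.to P⇔Q p) ¬q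
    ... | no ¬p | yes q = contradiction (Equivalence.from P⇔Q q) ¬p

  length-filter-cong : ∀ xs → All (λ y → P y ⇔ Q y) xs →
    length (filter P? xs) ≡ length (filter Q? xs)
  length-filter-cong []       []       = refl
  length-filter-cong (_ ∷ ys) (e ∷ es) = length-filter-∷ 0 e (length-filter-cong ys es)

  length-filter-remove : ∀ {i xs} → Unique xs → i ∈ xs → P i → ¬ Q i →
    (∀ {y} → y ≢ i → P y ⇔ Q y) → length (filter P? xs) ≡ suc (length (filter Q? xs))
  length-filter-remove {i} (i≢ys ∷ _) (here refl) pi ¬qi P⇔Q with P? i | Q? i
  ... | yes _  | no _   =
    cong suc (length-filter-cong _ (All.map (λ i≢y → P⇔Q (≢-sym i≢y)) i≢ys))
  ... | yes _  | yes qi = contradiction qi ¬qi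
  ... | no ¬pi | _      = contradiction pi ¬pi
  length-filter-remove (y≢ys ∷ u) (there i∈ys) pi ¬qi P⇔Q =
    length-filter-∷ 1 (P⇔Q (All.lookup y≢ys i∈ys)) (length-filter-remove u i∈ys pi ¬qi P⇔Q)

module _ {n : ℕ} where

  r-cong : ∀ {y z : Schedule n} {τ} → (∀ j → y j ≡ τ ⇔ z j ≡ τ) → r y τ ≡ r z τ
  r-cong {y} {z} {τ} y⇔z =
    length-filter-cong (λ j → y j ≟ τ) (λ j → z j ≟ τ) (allFin n) (All.universal y⇔z _)

  r-remove : ∀ {y z : Schedule n} {τ i} → y i ≡ τ → z i ≢ τ →
    (∀ {j} → j ≢ i → y j ≡ τ ⇔ z j ≡ τ) → r y τ ≡ suc (r z τ)
  r-remove {y} {z} {τ} {i} =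
    length-filter-remove (λ j → y j ≟ τ) (λ j → z j ≟ τ) (allFin⁺ n) (∈-allFin i)

  private
    others : Schedule n → ℕ → Fin n → ℕ
    others y τ i = length (filter (λ j → (y j ≟ τ) ×-dec ¬? (j Fin.≟ i)) (allFin n))

    r≡1+others : ∀ {y : Schedule n} {τ i} → y i ≡ τ → r y τ ≡ suc (others y τ i)
    r≡1+others {i = i} yi = length-filter-remove _ _ (allFin⁺ n) (∈-allFin i) yi
      (λ (_ , i≢i) → i≢i refl) (λ j≢i → mk⇔ (_, j≢i) proj₁)

  r≡1 : ∀ {y : Schedule n} {τ i} → y i ≡ τ → (∀ j → y j ≡ τ → j ≡ i) → r y τ ≡ 1
  r≡1 {y} {τ} {i} yi alone = trans (r≡1+others yi) (cong (λ js → suc (length js))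
    (filter-none (λ j → (y j ≟ τ) ×-dec ¬? (j Fin.≟ i))
      (All.universal (λ j (yj , j≢i) → j≢i (alone j yj)) (allFin n))))

  2≤r : ∀ {y : Schedule n} {τ i j} → i ≢ j → y i ≡ τ → y j ≡ τ → 2 ≤ r y τ
  2≤r {y} {τ} {i} {j} i≢j yi yj = subst (2 ≤_) (sym (r≡1+others yi))
    (s≤s (filter-some (λ k → (y k ≟ τ) ×-dec ¬? (k Fin.≟ i))
      (lose (∈-allFin j) (yj , ≢-sym i≢j))))

  Cmax-upper : ∀ (y : Schedule n) j → suc (y j) ≤ Cmax y
  Cmax-upper y j = go {allFin n} (∈-allFin j)
    where
      go : ∀ {is} → j ∈ is → suc (y j) ≤ foldr (λ i m → suc (y i) ⊔ m) 0 is
      go {_ ∷ is} (here refl) = m≤m⊔n _ (foldr (λ i m → suc (y i) ⊔ m) 0 is)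
      go (there j∈is)         = ≤-trans (go j∈is) (m≤n⊔m _ _)

  Cmax-least : ∀ (y : Schedule n) {K} → (∀ j → suc (y j) ≤ K) → Cmax y ≤ K
  Cmax-least y {K} bound = go (allFin n)
    where
      go : ∀ is → foldr (λ i m → suc (y i) ⊔ m) 0 is ≤ K
      go []       = z≤n
      go (i ∷ is) = ⊔-lub (bound i) (go is)

sum-map-+ : ∀ {A : Set} (f g : A → ℕ) xs →
  sum (map (λ τ → f τ + g τ) xs) ≡ sum (map f xs) + sum (map g xs)
sum-map-+ f g []       = refl
sum-map-+ f g (y ∷ ys) =
  trans (cong (f y + g y +_) (sum-map-+ f g ys)) (interchange (f y) (g y) _ _)

sum-upTo-suc : ∀ (f : ℕ → ℕ) C → sum (map f (upTo (suc C))) ≡ sum (map f (upTo C)) + f C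
sum-upTo-suc f C = begin
  sum (map f (upTo (suc C)))        ≡⟨ cong (λ τs → sum (map f τs)) (upTo-∷ʳ C) ⟨
  sum (map f (upTo C ++ C ∷ []))    ≡⟨ cong sum (map-++ f (upTo C) (C ∷ [])) ⟩
  sum (map f (upTo C) ++ f C ∷ [])  ≡⟨ sum-++ (map f (upTo C)) (f C ∷ []) ⟩
  sum (map f (upTo C)) + (f C + 0)  ≡⟨ cong (sum (map f (upTo C)) +_) (+-identityʳ (f C)) ⟩
  sum (map f (upTo C)) + f C        ∎
  where open ≡-Reasoning

pointMass : ℕ → ℕ → ℕ → ℕ
pointMass p w τ = if does (τ ≟ p) then w else 0

pointMass-≡ : ∀ p w → pointMass p w p ≡ w
pointMass-≡ p w = cong (if_then w else 0) (dec-true (p ≟ p) refl)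

pointMass-≢ : ∀ {p τ} w → τ ≢ p → pointMass p w τ ≡ 0
pointMass-≢ {p} {τ} w τ≢p = cong (if_then w else 0) (dec-false (τ ≟ p) τ≢p)

sum-pointMass-≤ : ∀ {p} w C → C ≤ p → sum (map (pointMass p w) (upTo C)) ≡ 0
sum-pointMass-≤ w zero    _   = refl
sum-pointMass-≤ w (suc C) C<p = trans (sum-upTo-suc (pointMass _ w) C)
  (cong₂ _+_ (sum-pointMass-≤ w C (<⇒≤ C<p)) (pointMass-≢ w (<⇒≢ C<p)))

sum-pointMass : ∀ {p} w C → p < C → sum (map (pointMass p w) (upTo C)) ≡ w
sum-pointMass {p} w (suc C) p<1+C with p ≟ C
... | yes refl = trans (sum-upTo-suc (pointMass p w) p)
  (cong₂ _+_ (sum-pointMass-≤ w p ≤-refl) (pointMass-≡ p w))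
... | no p≢C   = trans (sum-upTo-suc (pointMass p w) C) (trans
  (cong₂ _+_ (sum-pointMass w C (≤∧≢⇒< (≤-pred p<1+C) p≢C)) (pointMass-≢ w (≢-sym p≢C)))
  (+-identityʳ w))

reach-trans : ∀ {n} {Arc : Fin n → Fin n → Set} {i j k} →
  Reach Arc i j → Reach Arc j k → Reach Arc i k
reach-trans (step e)   r′ = cons e r′
reach-trans (cons e r) r′ = cons e (reach-trans r r′)

module TightPaths {n} {Arc : Fin n → Fin n → Set} {M} {x : Schedule n}
                  (feasible : Feasible Arc M x) where

  arc-< : ∀ {i j} → Arc i j → x i < x j
  arc-< {i} {j} e = subst (_≤ x j) (+-comm (x i) 1) (proj₁ feasible i j e)

  <M : ∀ j → x j < M
  <M j = ≤-trans (Cmax-upper x j) (proj₂ feasible)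

  path-fits : ∀ {h t} → IsPath Arc (h ∷ t) → x h + length (h ∷ t) ≤ M
  path-fits (one h) = subst (_≤ M) (+-comm 1 (x h)) (<M h)
  path-fits {h} (more {j = j} {ps = t} e p) = begin
    x h + suc (length (j ∷ t))  ≡⟨ +-suc (x h) _ ⟩
    suc (x h) + length (j ∷ t)  ≤⟨ +-monoˡ-≤ _ (arc-< e) ⟩
    x j + length (j ∷ t)        ≤⟨ path-fits p ⟩
    M                           ∎
    where open ≤-Reasoning

  -- c starts a path whose jobs are forced onto the consecutive steps x c, x c + 1, …, M - 1.
  Tight : Fin n → Set
  Tight c = ∃ λ t → IsPath Arc (c ∷ t) × M ≤ x c + length (c ∷ t)

  tight-step : ∀ {h} → Tight h → suc (x h) < M →
    ∃ λ j → Arc h j × x j ≡ suc (x h) × Tight j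
  tight-step {h} (_ , one h , M≤) 2+h≤M =
    contradiction (subst (M ≤_) (+-comm (x h) 1) M≤) (<⇒≱ 2+h≤M)
  tight-step {h} (_ , more {j = j} {ps = t} e p , M≤) _ =
    j , e , xj≡ , t , p , subst (λ v → M ≤ v + length (j ∷ t)) (sym xj≡) M≤′
    where
      M≤′ : M ≤ suc (x h) + length (j ∷ t)
      M≤′ = subst (M ≤_) (+-suc (x h) _) M≤
      xj≡ : x j ≡ suc (x h)
      xj≡ = ≤-antisym (+-cancelʳ-≤ _ _ _ (≤-trans (path-fits p) M≤′)) (arc-< e)

  tight-reach : ∀ {h τ} → Tight h → x h < τ → τ < M →
    ∃ λ c → x c ≡ τ × Reach Arc h c × Tight c
  tight-reach {h} {suc τ} th h<1+τ 1+τ<M with x h ≟ τ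
  ... | yes refl = let j , e , xj , tj = tight-step th 1+τ<M in j , xj , step e , tj
  ... | no h≢τ with tight-reach th (≤∧≢⇒< (≤-pred h<1+τ) h≢τ) (<-trans (n<1+n τ) 1+τ<M)
  ...   | c , refl , h⇝c , tc =
    let j , e , xj , tj = tight-step tc 1+τ<M in j , xj , reach-trans h⇝c (step e) , tj

  tight-cover : ∀ {h τ} → Tight h → x h ≤ τ → τ < M → ∃ λ c → x c ≡ τ × Tight c
  tight-cover {h} {τ} th h≤τ τ<M with x h ≟ τ
  ... | yes xh≡τ = h , xh≡τ , th
  ... | no xh≢τ  =
    let c , xc , _ , tc = tight-reach th (≤∧≢⇒< h≤τ xh≢τ) τ<M in c , xc , tc

  long-path-tight : ∀ {Q} → IsPath Arc Q → M ≤ length Q →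
    ∀ {τ} → τ < M → ∃ λ c → x c ≡ τ × Tight c
  long-path-tight {[]}    _ M≤0 τ<M = contradiction (≤-trans τ<M M≤0) λ ()
  long-path-tight {h ∷ t} p M≤Q {τ} τ<M =
    tight-cover (t , p , ≤-trans M≤Q (m≤n+m _ (x h))) xh≤τ τ<M
    where
      xh≤τ : x h ≤ τ
      xh≤τ = ≤-trans (+-cancelʳ-≤ (length (h ∷ t)) (x h) 0 (≤-trans (path-fits p) M≤Q)) z≤n

T-does⇔ : ∀ {A : Set} (a? : Dec A) → T (does a?) ⇔ A
T-does⇔ (yes a) = mk⇔ (λ _ → a) _
T-does⇔ (no ¬a) = mk⇔ (λ ()) ¬a

module ElementaryOperation {n} (Arc : Fin n → Fin n → Set) (x : Schedule n) (a b : Fin n)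
                           (pred? : ∀ j → Dec (Reach Arc j b)) where

  open Elementary Arc x a b pred?

  PredAt : ℕ → Set
  PredAt τ = ∃ λ j → Reach Arc j b × x j ≡ τ

  hasPred⇔PredAt : ∀ {τ} → T (hasPred τ) ⇔ PredAt τ
  hasPred⇔PredAt {τ} = mk⇔
    (λ h → let j , pj = satisfied (any⁻ isPredAt (allFin n) h)
           in j , Equivalence.to (T-does⇔ (isPredAt? j)) pj)
    (λ (j , pj) →
      any⁺ isPredAt (lose (∈-allFin j) (Equivalence.from (T-does⇔ (isPredAt? j)) pj)))
    where
      isPredAt? : ∀ j → Dec (Reach Arc j b × x j ≡ τ)
      isPredAt? j = pred? j ×-dec (x j ≟ τ)
      isPredAt : Fin n → Bool
      isPredAt j = does (isPredAt? j)

  predAt? : Decidable PredAt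
  predAt? τ = Dec.map hasPred⇔PredAt (T? (hasPred τ))

  -- Below x b these are exactly τ_0 = x a < τ_1 < … < τ_K.
  Breakpoint : ℕ → Set
  Breakpoint τ = τ ≡ x a ⊎ (x a < τ × PredAt τ)

  Breakpoint-≥ : ∀ {τ} → Breakpoint τ → x a ≤ τ
  Breakpoint-≥ (inj₁ refl)      = ≤-refl
  Breakpoint-≥ (inj₂ (a<τ , _)) = <⇒≤ a<τ

  private
    above? : ∀ s → Dec (x a < s × PredAt s)
    above? s = (x a <? s) ×-dec predAt? s

  prev-suc-above : ∀ {s} → x a < s × PredAt s → prev (suc s) ≡ s
  prev-suc-above {s} above = cong (if_then s else prev s) (dec-true (above? s) above)

  prev-suc-¬above : ∀ {s} → ¬ (x a < s × PredAt s) → prev (suc s) ≡ prev s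
  prev-suc-¬above {s} ¬above = cong (if_then s else prev s) (dec-false (above? s) ¬above)

  prev-spec : ∀ t → prev t ≡ x a ⊎ (x a < prev t × prev t < t × PredAt (prev t))
  prev-spec zero = inj₁ refl
  prev-spec (suc s) with above? s
  ... | yes above@(a<s , ps) rewrite prev-suc-above above = inj₂ (a<s , ≤-refl , ps)
  ... | no ¬above rewrite prev-suc-¬above ¬above with prev-spec s
  ...   | inj₁ ≡a               = inj₁ ≡a
  ...   | inj₂ (a< , <s , ps)   = inj₂ (a< , m<n⇒m<1+n <s , ps)

  prev-≥ : ∀ t → x a ≤ prev t
  prev-≥ t with prev-spec t
  ... | inj₁ ≡a           = ≤-reflexive (sym ≡a)
  ... | inj₂ (a< , _ , _) = <⇒≤ a<

  prev-< : ∀ {t} → x a < t → prev t < t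
  prev-< {t} a<t with prev-spec t
  ... | inj₁ ≡a           = subst (_< t) (sym ≡a) a<t
  ... | inj₂ (_ , <t , _) = <t

  prev-maximal : ∀ {τ t} → Breakpoint τ → τ < t → τ ≤ prev t
  prev-maximal {τ} {suc s} bτ τ<1+s with above? s
  ... | yes above rewrite prev-suc-above above = ≤-pred τ<1+s
  ... | no ¬above rewrite prev-suc-¬above ¬above with τ ≟ s | bτ
  ...   | no τ≢s   | _          = prev-maximal bτ (≤∧≢⇒< (≤-pred τ<1+s) τ≢s)
  ...   | yes refl | inj₁ refl  = prev-≥ s
  ...   | yes refl | inj₂ above = contradiction above ¬above

  Shifted : Fin n → Set
  Shifted j = Reach Arc j b × x a < x j × x j < x b

  Moved : Fin n → Set
  Moved j = j ≡ b ⊎ Shifted j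

  shifted? : Decidable Shifted
  shifted? j = pred? j ×-dec (x a <? x j) ×-dec (x j <? x b)

  moved? : Decidable Moved
  moved? j = (j Fin.≟ b) ⊎-dec shifted? j

  x′-moved : ∀ {j} → Moved j → x′ j ≡ prev (x j)
  x′-moved {j} mj with j Fin.≟ b
  ... | yes refl = refl
  ... | no j≢b with mj
  ...   | inj₁ j≡b = contradiction j≡b j≢b
  ...   | inj₂ sj  = cong (if_then prev (x j) else x j) (dec-true (shifted? j) sj)

  x′-unmoved : ∀ {j} → ¬ Moved j → x′ j ≡ x j
  x′-unmoved {j} ¬mj with j Fin.≟ b
  ... | yes j≡b = contradiction (inj₁ j≡b) ¬mj
  ... | no _    = cong (if_then prev (x j) else x j) (dec-false (shifted? j) (¬mj ∘ inj₂))

  module Analysis {M} (feasible : Feasible Arc M x)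
                  {P} (path : IsPath Arc P) (M≤P : M ≤ length P)
                  (independent : Independent Arc a b) (a<b : x a < x b)
                  (alone : ∀ j → x j ≡ x a → j ≡ a) where

    open TightPaths feasible

    ¬a⇝b : ¬ Reach Arc a b
    ¬a⇝b = proj₁ (proj₂ independent)

    moved⇝b : ∀ {j} → Moved j → j ≡ b ⊎ Reach Arc j b
    moved⇝b (inj₁ j≡b)       = inj₁ j≡b
    moved⇝b (inj₂ (j⇝b , _)) = inj₂ j⇝b

    a<moved : ∀ {j} → Moved j → x a < x j
    a<moved (inj₁ refl)          = a<b
    a<moved (inj₂ (_ , a<j , _)) = a<j

    moved≤b : ∀ {j} → Moved j → x j ≤ x b
    moved≤b (inj₁ refl)          = ≤-refl
    moved≤b (inj₂ (_ , _ , j<b)) = <⇒≤ j<b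

    x′<x-moved : ∀ {j} → Moved j → x′ j < x j
    x′<x-moved mj = subst (_< _) (sym (x′-moved mj)) (prev-< (a<moved mj))

    x′≤x : ∀ j → x′ j ≤ x j
    x′≤x j with moved? j
    ... | yes mj = <⇒≤ (x′<x-moved mj)
    ... | no ¬mj = ≤-reflexive (x′-unmoved ¬mj)

    reached-unmoved : ∀ {c} → Reach Arc a c → ¬ Moved c
    reached-unmoved a⇝c mc with moved⇝b mc
    ... | inj₁ refl = ¬a⇝b a⇝c
    ... | inj₂ c⇝b  = ¬a⇝b (reach-trans a⇝c c⇝b)

    a-unmoved : ¬ Moved a
    a-unmoved ma with moved⇝b ma
    ... | inj₁ a≡b = proj₁ independent a≡b
    ... | inj₂ a⇝b = ¬a⇝b a⇝b

    moved≢unmoved : ∀ {j c} → Moved j → ¬ Moved c → j ≢ c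
    moved≢unmoved mj ¬mc refl = ¬mc mj

    x′-arc : ∀ {i j} → Arc i j → x′ i < x′ j
    x′-arc {i} {j} e with moved? j
    ... | no ¬mj = subst (x′ i <_) (sym (x′-unmoved ¬mj)) (≤-<-trans (x′≤x i) (arc-< e))
    ... | yes mj = subst (x′ i <_) (sym (x′-moved mj)) (into-moved (moved? i))
      where
        i⇝b : Reach Arc i b
        i⇝b with moved⇝b mj
        ... | inj₁ refl = step e
        ... | inj₂ j⇝b  = cons e j⇝b
        into-moved : Dec (Moved i) → x′ i < prev (x j)
        into-moved (yes mi) = begin-strict
          x′ i        ≡⟨ x′-moved mi ⟩
          prev (x i)  <⟨ prev-< (a<moved mi) ⟩
          x i         ≤⟨ prev-maximal (inj₂ (a<moved mi , i , i⇝b , refl)) (arc-< e) ⟩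
          prev (x j)  ∎
          where open ≤-Reasoning
        into-moved (no ¬mi) = begin-strict
          x′ i        ≡⟨ x′-unmoved ¬mi ⟩
          x i         <⟨ ≤∧≢⇒< (≮⇒≥ (λ a<i → ¬mi (inj₂ (i⇝b , a<i , i<b)))) xi≢xa ⟩
          x a         ≤⟨ prev-≥ (x j) ⟩
          prev (x j)  ∎
          where
            open ≤-Reasoning
            i<b : x i < x b
            i<b = <-≤-trans (arc-< e) (moved≤b mj)
            xi≢xa : x i ≢ x a
            xi≢xa xi≡xa = ¬a⇝b (subst (λ k → Reach Arc k b) (alone i xi≡xa) i⇝b)

    feasible′ : Feasible Arc M x′
    feasible′ = (λ i j e → subst (_≤ x′ j) (+-comm 1 (x′ i)) (x′-arc e))
              , Cmax-least x′ (λ j → ≤-trans (s≤s (x′≤x j)) (<M j))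

    a-tight : Tight a
    a-tight with long-path-tight path M≤P (<M a)
    ... | c , xc≡xa , tc = subst Tight (alone c xc≡xa) tc

    unmoved-at : ∀ {τ} → x a < τ → τ < M → ∃ λ c → x c ≡ τ × ¬ Moved c
    unmoved-at a<τ τ<M with tight-reach a-tight a<τ τ<M
    ... | c , xc , a⇝c , _ = c , xc , reached-unmoved a⇝c

    -- Walk down the breakpoints from x b: the moved jobs at the lowest breakpoint above τ
    -- land on τ.
    lands : ∀ {τ} → Breakpoint τ → τ < x b → ∃ λ k → Moved k × x′ k ≡ τ
    lands {τ} bτ τ<b = go (<-wellFounded (x b)) τ<b ≤-refl (b , inj₁ refl , refl)
      where
        go : ∀ {t} → Acc _<_ t → τ < t → t ≤ x b → (∃ λ j → Moved j × x j ≡ t) →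
             ∃ λ k → Moved k × x′ k ≡ τ
        go {t} (acc rec) τ<t t≤b (j , mj , refl) with τ ≟ prev t | prev-spec t
        ... | yes τ≡ | _ = j , mj , trans (x′-moved mj) (sym τ≡)
        ... | no τ≢  | inj₁ ≡a = contradiction
          (≤-antisym (prev-maximal bτ τ<t) (subst (_≤ τ) (sym ≡a) (Breakpoint-≥ bτ))) τ≢
        ... | no τ≢  | inj₂ (a< , <t , i , i⇝b , xi≡) =
          go (rec <t) (≤∧≢⇒< (prev-maximal bτ τ<t) τ≢) (<⇒≤ prev<b)
             (i , inj₂ (i⇝b , subst (x a <_) (sym xi≡) a< , subst (_< x b) (sym xi≡) prev<b)
                , xi≡)
          where
            prev<b : prev t < x b
            prev<b = <-≤-trans <t t≤b

    r-at-a≡1 : r x (x a) ≡ 1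
    r-at-a≡1 = r≡1 refl alone

    2≤r′-at-a : 2 ≤ r x′ (x a)
    2≤r′-at-a with lands (inj₁ refl) a<b
    ... | k , mk , x′k = 2≤r (moved≢unmoved mk a-unmoved) x′k (x′-unmoved a-unmoved)

    r-at-b≡1+r′ : r x (x b) ≡ suc (r x′ (x b))
    r-at-b≡1+r′ = r-remove refl (<⇒≢ (x′<x-moved (inj₁ refl))) stays
      where
        stays : ∀ {j} → j ≢ b → x j ≡ x b ⇔ x′ j ≡ x b
        stays {j} j≢b with moved? j
        ... | no ¬mj = mk⇔ (trans (x′-unmoved ¬mj)) (trans (sym (x′-unmoved ¬mj)))
        ... | yes (inj₁ j≡b) = contradiction j≡b j≢b
        ... | yes mj@(inj₂ (_ , _ , j<b)) =
          mk⇔ (λ xj≡xb → contradiction xj≡xb (<⇒≢ j<b))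
              (λ x′j≡xb → contradiction x′j≡xb (<⇒≢ (<-trans (x′<x-moved mj) j<b)))

    2≤r-at-b : 2 ≤ r x (x b)
    2≤r-at-b with unmoved-at a<b (<M b)
    ... | c , xc , ¬mc = 2≤r (moved≢unmoved (inj₁ refl) ¬mc) refl xc

    Interior : ℕ → Set
    Interior τ = x a < τ × τ < x b × PredAt τ

    interior? : Decidable Interior
    interior? τ = (x a <? τ) ×-dec (τ <? x b) ×-dec predAt? τ

    2≤r-interior : ∀ {τ} → Interior τ → 2 ≤ r x τ × 2 ≤ r x′ τ
    2≤r-interior (a<τ , τ<b , j , j⇝b , refl)
      with unmoved-at a<τ (<-trans τ<b (<M b)) | lands (inj₂ (a<τ , j , j⇝b , refl)) τ<b
    ... | c , xc , ¬mc | k , mk , x′k =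
        2≤r (moved≢unmoved (inj₂ (j⇝b , a<τ , τ<b)) ¬mc) refl xc
      , 2≤r (moved≢unmoved mk ¬mc) x′k (trans (x′-unmoved ¬mc) xc)

    Special : ℕ → Set
    Special τ = τ ≡ x a ⊎ τ ≡ x b ⊎ Interior τ

    moved-from-Special : ∀ {j} → Moved j → Special (x j)
    moved-from-Special (inj₁ refl)              = inj₂ (inj₁ refl)
    moved-from-Special (inj₂ (j⇝b , a<j , j<b)) = inj₂ (inj₂ (a<j , j<b , _ , j⇝b , refl))

    moved-to-Special : ∀ {j} → Moved j → Special (x′ j)
    moved-to-Special {j} mj rewrite x′-moved mj with prev-spec (x j)
    ... | inj₁ ≡a               = inj₁ ≡a
    ... | inj₂ (a< , <j , pred) = inj₂ (inj₂ (a< , <-≤-trans <j (moved≤b mj) , pred))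

    r′≡r-elsewhere : ∀ {τ} → ¬ Special τ → r x′ τ ≡ r x τ
    r′≡r-elsewhere {τ} ¬special = r-cong stays
      where
        stays : ∀ j → x′ j ≡ τ ⇔ x j ≡ τ
        stays j with moved? j
        ... | no ¬mj = mk⇔ (trans (sym (x′-unmoved ¬mj))) (trans (x′-unmoved ¬mj))
        ... | yes mj = mk⇔ (λ { refl → contradiction (moved-to-Special mj) ¬special })
                           (λ { refl → contradiction (moved-from-Special mj) ¬special })

    Cmax-x′ : Cmax x′ ≡ Cmax x
    Cmax-x′ = ≤-antisym (Cmax-least x′ (λ j → ≤-trans (s≤s (x′≤x j)) (Cmax-upper x j)))
                        (≤-trans (proj₂ feasible) (reached M (<M b) ≤-refl))
      where
        reached : ∀ m → x b < m → m ≤ M → m ≤ Cmax x′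
        reached (suc m) b<1+m 1+m≤M with unmoved-at (<-≤-trans a<b (≤-pred b<1+m)) 1+m≤M
        ... | c , xc , ¬mc =
          subst (λ v → suc v ≤ Cmax x′) (trans (x′-unmoved ¬mc) xc) (Cmax-upper x′ c)

    load : Schedule n → ℕ → ℕ
    load y τ = 2 ⊓ r y τ

    load′≤load-at-b : load x′ (x b) ≤ load x (x b)
    load′≤load-at-b = ⊓-monoʳ-≤ 2 (subst (r x′ (x b) ≤_) (sym r-at-b≡1+r′) (n≤1+n _))

    loss : ℕ
    loss = load x (x b) ∸ load x′ (x b)

    load-balance : ∀ τ → load x′ τ + pointMass (x b) loss τ ≡ load x τ + pointMass (x a) 1 τ
    load-balance τ with τ ≟ x a | τ ≟ x b | interior? τ
    ... | yes refl | _ | _ = begin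
      load x′ (x a) + pointMass (x b) loss (x a)
        ≡⟨ cong₂ _+_ (m≤n⇒m⊓n≡m 2≤r′-at-a) (pointMass-≢ loss (<⇒≢ a<b)) ⟩
      2 + 0
        ≡⟨ cong₂ _+_ (cong (2 ⊓_) r-at-a≡1) (pointMass-≡ (x a) 1) ⟨
      load x (x a) + pointMass (x a) 1 (x a) ∎
      where open ≡-Reasoning
    ... | no b≢a | yes refl | _ = begin
      load x′ (x b) + pointMass (x b) loss (x b) ≡⟨ cong (load x′ (x b) +_) (pointMass-≡ (x b) loss) ⟩
      load x′ (x b) + loss                       ≡⟨ m+[n∸m]≡n load′≤load-at-b ⟩
      load x (x b)                               ≡⟨ +-identityʳ _ ⟨
      load x (x b) + 0                           ≡⟨ cong (load x (x b) +_) (pointMass-≢ 1 b≢a) ⟨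
      load x (x b) + pointMass (x a) 1 (x b)     ∎
      where open ≡-Reasoning
    ... | no τ≢a | no τ≢b | yes int =
      trans (cong₂ _+_ (m≤n⇒m⊓n≡m (proj₂ (2≤r-interior int))) (pointMass-≢ loss τ≢b))
            (sym (cong₂ _+_ (m≤n⇒m⊓n≡m (proj₁ (2≤r-interior int))) (pointMass-≢ 1 τ≢a)))
    ... | no τ≢a | no τ≢b | no ¬int =
      cong₂ _+_ (cong (2 ⊓_) (r′≡r-elsewhere [ τ≢a , [ τ≢b , ¬int ] ]))
                (trans (pointMass-≢ loss τ≢b) (sym (pointMass-≢ 1 τ≢a)))

    F-balance : F x′ + loss ≡ F x + 1
    F-balance = begin
      F x′ + loss
        ≡⟨ cong₂ _+_ (cong (λ C → sum (map (load x′) (upTo C))) Cmax-x′)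
                     (sym (sum-pointMass loss _ (Cmax-upper x b))) ⟩
      sum (map (load x′) τs) + sum (map (pointMass (x b) loss) τs)
        ≡⟨ sum-map-+ (load x′) (pointMass (x b) loss) τs ⟨
      sum (map (λ τ → load x′ τ + pointMass (x b) loss τ) τs)
        ≡⟨ cong sum (map-cong load-balance τs) ⟩
      sum (map (λ τ → load x τ + pointMass (x a) 1 τ) τs)
        ≡⟨ sum-map-+ (load x) (pointMass (x a) 1) τs ⟩
      F x + sum (map (pointMass (x a) 1) τs)
        ≡⟨ cong (F x +_) (sum-pointMass 1 _ (<-trans a<b (Cmax-upper x b))) ⟩
      F x + 1 ∎
      where
        open ≡-Reasoning
        τs : List ℕ
        τs = upTo (Cmax x)

    loss-two : r x (x b) ≡ 2 → loss ≡ 1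
    loss-two r≡2 rewrite r≡2 | suc-injective (trans (sym r-at-b≡1+r′) r≡2) = refl

    loss-not-two : r x (x b) ≢ 2 → loss ≡ 0
    loss-not-two r≢2 = cong₂ _∸_ (m≤n⇒m⊓n≡m 2≤r-at-b) (m≤n⇒m⊓n≡m 2≤r′-at-b)
      where
        2≤r′-at-b : 2 ≤ r x′ (x b)
        2≤r′-at-b = ≤-pred (subst (3 ≤_) r-at-b≡1+r′ (≤∧≢⇒< 2≤r-at-b (≢-sym r≢2)))

    F-preserved : r x (x b) ≡ 2 → F x′ ≡ F x
    F-preserved r≡2 =
      +-cancelʳ-≡ 1 (F x′) (F x) (subst (λ l → F x′ + l ≡ F x + 1) (loss-two r≡2) F-balance)

    F-increased : r x (x b) ≢ 2 → F x′ ≡ suc (F x)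
    F-increased r≢2 = begin
      F x′         ≡⟨ +-identityʳ (F x′) ⟨
      F x′ + 0     ≡⟨ cong (F x′ +_) (loss-not-two r≢2) ⟨
      F x′ + loss  ≡⟨ F-balance ⟩
      F x + 1      ≡⟨ +-comm (F x) 1 ⟩
      suc (F x)    ∎
      where open ≡-Reasoning

proposition1 : (n : ℕ) (Arc : Fin n → Fin n → Set) → Acyclic Arc →
    (P : List (Fin n)) → IsCriticalPath Arc P →
    (x : Schedule n) → Feasible Arc (length P) x →
    (a b : Fin n) → Independent Arc a b → x a < x b →
    (∀ j → x j ≡ x a → j ≡ a) →
    (pred? : ∀ j → Dec (Reach Arc j b)) →
    Feasible Arc (length P) (elementaryOp Arc x a b pred?)
    × (r x (x b) ≡ 2 → F (elementaryOp Arc x a b pred?) ≡ F x)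
    × (r x (x b) ≢ 2 → F (elementaryOp Arc x a b pred?) ≡ suc (F x))
proposition1 n Arc _ P (path , _) x feasible a b independent a<b alone pred? =
  feasible′ , F-preserved , F-increased
  where
    open ElementaryOperation Arc x a b pred?
    open Analysis feasible path ≤-refl independent a<b alone
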